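{- Let $X\subseteq\{0,1\}^n$ and let $L$ and $L'$ be two orderings of $X$. If $L$ is genlex, then $c(L)\le c(L')$. Moreover, this inequality is strict if $L'$ is not genlex.
   Context: An ordering of $X$ is a sequence containing every element of $X$ exactly once. An ordering is genlex if, for every $k$, all bitstrings in $X$ having the same suffix of length $k$ appear consecutively in it. For distinct $x,y\in\{0,1\}^n$ let $\lambda(x,y):=\max\{i\in[n]: x_i\neq y_i\}$. The cost of an ordering $L=x_1,\dots,x_\ell$ is $c(L):=\sum_{i=1}^{\ell-1}\lambda(x_i,x_{i+1})$. -}

module Defs where

open import Data.Bool using (Bool; if_then_else_)
open import Data.Bool.Properties using () renaming (_≟_ to _≟B_)
open import Data.Nat using (ℕ; zero; suc; _+_; _∸_; _<_)
open import Data.Vec using (Vec; []; _∷_; toList)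
open import Data.List using (List; []; _∷_; length; lookup; drop)
open import Data.Fin using (Fin; toℕ)
open import Data.List.Relation.Unary.Unique.Propositional using (Unique)
open import Data.List.Relation.Binary.Permutation.Propositional using (_↭_)
open import Relation.Nullary using (does)
open import Relation.Binary.PropositionalEquality using (_≡_)

-- Bitstrings of length n: x = x_1 x_2 ... x_n, with x_1 the head of the vector.
Bits : ℕ → Set
Bits n = Vec Bool n

-- λ(x,y) = max { i ∈ [n] : x_i ≠ y_i }  (1-based); returns 0 when x = y
-- (this value is never used for equal strings, since orderings have no repeats).
lam : ∀ {n} → Bits n → Bits n → ℕ
lam [] [] = 0
lam (a ∷ x) (b ∷ y) with lam x y
... | zero  = if does (a ≟B b) then 0 else 1
... | suc m = suc (suc m)

cost : ∀ {n} → List (Bits n) → ℕ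
cost [] = 0
cost (x ∷ []) = 0
cost (x ∷ y ∷ L) = lam x y + cost (y ∷ L)

suffix : ∀ {n} → ℕ → Bits n → List Bool
suffix {n} k x = drop (n ∸ k) (toList x)

-- An ordering of X: a sequence containing every element of X exactly once.
-- X is given as a duplicate-free list of its elements.
IsOrdering : ∀ {n} → List (Bits n) → List (Bits n) → Set
IsOrdering X L = L ↭ X

-- genlex: for every k, the elements with a common suffix of length k appear
-- consecutively, i.e. if positions i < j < l have equal k-suffix at i and l,
-- position j has the same k-suffix.
Genlex : ∀ {n} → List (Bits n) → Set
Genlex {n} L = ∀ (k : ℕ) (i j l : Fin (length L)) →
  toℕ i < toℕ j → toℕ j < toℕ l →
  suffix k (lookup L i) ≡ suffix k (lookup L l) →
  suffix k (lookup L j) ≡ suffix k (lookup L i)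

{-# OPTIONS --safe #-}
module Submission where

-- For a key function on a list, the number of adjacent pairs with different keys is at least
-- (number of distinct keys) − 1, with equality exactly when equal keys occur consecutively;
-- the number of distinct keys is invariant under permutation. Since λ(x,y) counts the k ≥ 1
-- for which the k-suffixes of x and y differ, c(L) is the sum over k of the breaks of L
-- keyed by k-suffixes. A genlex L attains every lower bound, so c(L) ≤ c(L′); if the costs
-- are equal then every summand is equal, so L′ attains every bound and is genlex.

open import Defs
open import Data.Nat using (ℕ; zero; suc; _+_; _≤_; _<_; z≤n; s≤s; s≤s⁻¹; _≤?_; _<?_)
open import Data.Nat.Properties
open import Algebra.Properties.CommutativeSemigroup +-commutativeSemigroup
  using () renaming (interchange to +-interchange)
open import Data.Bool using (Bool; if_then_else_)
open import Data.Bool.Properties using () renaming (_≟_ to _≟ᴮ_)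
open import Data.Vec using (toList) renaming ([] to []ᵛ; _∷_ to _∷ᵛ_)
open import Data.Vec.Properties using (toList-injective; cast-is-id; length-toList)
open import Data.List using (List; []; _∷_; length; lookup)
open import Data.List.Properties using (≡-dec; ∷-injectiveˡ; ∷-injectiveʳ; drop-all)
open import Data.List.Relation.Unary.Any using (Any; here; there; any?)
import Data.List.Relation.Unary.Any as Any
open import Data.List.Relation.Unary.Any.Properties using (lookup-index)
open import Data.List.Membership.Propositional using (lose)
open import Data.List.Membership.Propositional.Properties using (∈-lookup)
open import Data.List.Relation.Unary.Unique.Propositional using (Unique)
open import Data.List.Relation.Binary.Permutation.Propositional
  using (_↭_; prep; swap; ↭-sym; ↭-trans)
import Data.List.Relation.Binary.Permutation.Propositional as ↭
open import Data.List.Relation.Binary.Permutation.Propositional.Properties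
  using (Any-resp-↭; ¬x∷xs↭[])
open import Data.Fin using (Fin; toℕ) renaming (zero to fzero; suc to fsuc)
open import Data.Product using (_×_; _,_; proj₁; proj₂)
open import Data.Sum using (_⊎_; inj₁; inj₂)
open import Data.Empty using (⊥-elim)
open import Function using (_∘_)
open import Relation.Nullary using (¬_; Dec; yes; no; does)
open import Relation.Binary.Definitions using (DecidableEquality)
open import Relation.Binary.PropositionalEquality
  using (_≡_; refl; sym; trans; cong; cong₂; subst; subst₂; module ≡-Reasoning)

≤-summands : ∀ {a b c d} → a ≤ c → b ≤ d → c + d ≤ a + b → c ≤ a × d ≤ b
≤-summands {a} {b} {c} {d} a≤c b≤d c+d≤a+b =
  +-cancelʳ-≤ d c a (≤-trans c+d≤a+b (+-monoʳ-≤ a b≤d)) ,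
  +-cancelˡ-≤ c d b (≤-trans c+d≤a+b (+-monoˡ-≤ b a≤c))

sumBelow : ℕ → (ℕ → ℕ) → ℕ
sumBelow zero    g = 0
sumBelow (suc n) g = sumBelow n g + g n

sumBelow-0 : ∀ n → sumBelow n (λ _ → 0) ≡ 0
sumBelow-0 zero    = refl
sumBelow-0 (suc n) = trans (+-identityʳ _) (sumBelow-0 n)

sumBelow-cong : ∀ n {g h} → (∀ k → k < n → g k ≡ h k) → sumBelow n g ≡ sumBelow n h
sumBelow-cong zero    g≡h = refl
sumBelow-cong (suc n) g≡h = cong₂ _+_ (sumBelow-cong n (λ k k<n → g≡h k (m<n⇒m<1+n k<n))) (g≡h n ≤-refl)

sumBelow-+ : ∀ n g h → sumBelow n (λ k → g k + h k) ≡ sumBelow n g + sumBelow n h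
sumBelow-+ zero    g h = refl
sumBelow-+ (suc n) g h =
  trans (cong (_+ (g n + h n)) (sumBelow-+ n g h)) (+-interchange (sumBelow n g) (sumBelow n h) (g n) (h n))

sumBelow-mono : ∀ n {g h} → (∀ k → k < n → g k ≤ h k) → sumBelow n g ≤ sumBelow n h
sumBelow-mono zero    g≤h = z≤n
sumBelow-mono (suc n) g≤h = +-mono-≤ (sumBelow-mono n (λ k k<n → g≤h k (m<n⇒m<1+n k<n))) (g≤h n ≤-refl)

sumBelow-tight : ∀ n {g h} → (∀ k → k < n → g k ≤ h k) → sumBelow n h ≤ sumBelow n g →
                 ∀ k → k < n → h k ≤ g k
sumBelow-tight (suc n) {g} {h} g≤h Σh≤Σg k k<1+n = by-cases (m≤n⇒m<n∨m≡n (s≤s⁻¹ k<1+n))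
  where
  g≤h′ : ∀ j → j < n → g j ≤ h j
  g≤h′ j j<n = g≤h j (m<n⇒m<1+n j<n)

  summands : sumBelow n h ≤ sumBelow n g × h n ≤ g n
  summands = ≤-summands (sumBelow-mono n g≤h′) (g≤h n ≤-refl) Σh≤Σg

  by-cases : k < n ⊎ k ≡ n → h k ≤ g k
  by-cases (inj₁ k<n)  = sumBelow-tight n g≤h′ (proj₁ summands) k k<n
  by-cases (inj₂ refl) = proj₂ summands

module Keys {K : Set} (_≟_ : DecidableEquality K) where

  differ : K → K → ℕ
  differ u v with u ≟ v
  ... | yes _ = 0
  ... | no _  = 1

  differ-≡ : ∀ {u v} → u ≡ v → differ u v ≡ 0
  differ-≡ {u} {v} u≡v with u ≟ v
  ... | yes _  = refl
  ... | no u≢v = ⊥-elim (u≢v u≡v)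

  differ-≢ : ∀ {u v} → ¬ u ≡ v → differ u v ≡ 1
  differ-≢ {u} {v} u≢v with u ≟ v
  ... | yes u≡v = ⊥-elim (u≢v u≡v)
  ... | no _    = refl

  module _ {A : Set} (key : A → K) where

    breaks : List A → ℕ
    breaks []          = 0
    breaks (x ∷ [])    = 0
    breaks (x ∷ y ∷ L) = differ (key x) (key y) + breaks (y ∷ L)

    KeyOccurs : A → List A → Set
    KeyOccurs x = Any (λ z → key x ≡ key z)

    fresh : A → List A → ℕ
    fresh x L with any? (λ z → key x ≟ key z) L
    ... | yes _ = 0
    ... | no _  = 1

    -- fresh counts each key at its last occurrence
    distinctKeys : List A → ℕ
    distinctKeys []      = 0
    distinctKeys (x ∷ L) = fresh x L + distinctKeys L

    -- Genlex L k unfolds to Consecutive (suffix k) L.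
    Consecutive : List A → Set
    Consecutive L = ∀ (i j l : Fin (length L)) →
      toℕ i < toℕ j → toℕ j < toℕ l →
      key (lookup L i) ≡ key (lookup L l) →
      key (lookup L j) ≡ key (lookup L i)

    data Grouped : List A → Set where
      []  : Grouped []
      [_] : ∀ x → Grouped (x ∷ [])
      _∷_ : ∀ {x y L} → key x ≡ key y ⊎ ¬ KeyOccurs x (y ∷ L) →
            Grouped (y ∷ L) → Grouped (x ∷ y ∷ L)

    fresh-occurs : ∀ {x L} → KeyOccurs x L → fresh x L ≡ 0
    fresh-occurs {x} {L} occ with any? (λ z → key x ≟ key z) L
    ... | yes _    = refl
    ... | no ¬occ = ⊥-elim (¬occ occ)

    fresh-¬occurs : ∀ {x L} → ¬ KeyOccurs x L → fresh x L ≡ 1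
    fresh-¬occurs {x} {L} ¬occ with any? (λ z → key x ≟ key z) L
    ... | yes occ = ⊥-elim (¬occ occ)
    ... | no _    = refl

    fresh≤1 : ∀ x L → fresh x L ≤ 1
    fresh≤1 x L with any? (λ z → key x ≟ key z) L
    ... | yes _ = z≤n
    ... | no _  = ≤-refl

    fresh-cong : ∀ {x y L L′} → (KeyOccurs x L → KeyOccurs y L′) →
                 (KeyOccurs y L′ → KeyOccurs x L) → fresh x L ≡ fresh y L′
    fresh-cong {x} {y} {L} {L′} to from
      with any? (λ z → key x ≟ key z) L | any? (λ z → key y ≟ key z) L′
    ... | yes _ | yes _  = refl
    ... | no _  | no _   = refl
    ... | yes p | no ¬q = ⊥-elim (¬q (to p))
    ... | no ¬p | yes q = ⊥-elim (¬p (from q))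

    fresh-↭ : ∀ x {L L′} → L ↭ L′ → fresh x L ≡ fresh x L′
    fresh-↭ x σ = fresh-cong (Any-resp-↭ σ) (Any-resp-↭ (↭-sym σ))

    fresh-swap : ∀ x y L → fresh x (y ∷ L) + fresh y L ≡ fresh y (x ∷ L) + fresh x L
    fresh-swap x y L = by-cases (key x ≟ key y)
      where
      open ≡-Reasoning
      skip : ∀ {u v} → ¬ key u ≡ key v → fresh u (v ∷ L) ≡ fresh u L
      skip u≉v = fresh-cong (λ { (here u≈v) → ⊥-elim (u≉v u≈v) ; (there p) → p }) there

      by-cases : Dec (key x ≡ key y) → fresh x (y ∷ L) + fresh y L ≡ fresh y (x ∷ L) + fresh x L
      by-cases (yes x≈y) = cong₂ _+_
        (trans (fresh-occurs (here x≈y)) (sym (fresh-occurs (here (sym x≈y)))))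
        (fresh-cong (Any.map (trans x≈y)) (Any.map (trans (sym x≈y))))
      by-cases (no x≉y) = begin
        fresh x (y ∷ L) + fresh y L  ≡⟨ cong (_+ fresh y L) (skip x≉y) ⟩
        fresh x L + fresh y L        ≡⟨ +-comm (fresh x L) (fresh y L) ⟩
        fresh y L + fresh x L        ≡⟨ cong (_+ fresh x L) (skip (x≉y ∘ sym)) ⟨
        fresh y (x ∷ L) + fresh x L  ∎

    distinctKeys-↭ : ∀ {L L′} → L ↭ L′ → distinctKeys L ≡ distinctKeys L′
    distinctKeys-↭ ↭.refl        = refl
    distinctKeys-↭ (prep x σ)    = cong₂ _+_ (fresh-↭ x σ) (distinctKeys-↭ σ)
    distinctKeys-↭ (↭.trans σ τ) = trans (distinctKeys-↭ σ) (distinctKeys-↭ τ)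
    distinctKeys-↭ {x ∷ y ∷ L} {_ ∷ _ ∷ L′} (swap x y σ) = begin
      fresh x (y ∷ L) + (fresh y L + distinctKeys L)     ≡⟨ +-assoc (fresh x (y ∷ L)) _ _ ⟨
      fresh x (y ∷ L) + fresh y L + distinctKeys L       ≡⟨ cong (_+ distinctKeys L) (fresh-swap x y L) ⟩
      fresh y (x ∷ L) + fresh x L + distinctKeys L       ≡⟨ cong₂ _+_ (cong₂ _+_ (fresh-↭ y (prep x σ)) (fresh-↭ x σ))
                                                                        (distinctKeys-↭ σ) ⟩
      fresh y (x ∷ L′) + fresh x L′ + distinctKeys L′    ≡⟨ +-assoc (fresh y (x ∷ L′)) _ _ ⟩
      fresh y (x ∷ L′) + (fresh x L′ + distinctKeys L′)  ∎
      where open ≡-Reasoning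

    Grouped⇒Consecutive : ∀ {L} → Grouped L → Consecutive L
    Grouped⇒Consecutive [ x ] fzero fzero fzero () _ _
    Grouped⇒Consecutive (_ ∷ g) (fsuc i) (fsuc j) (fsuc l) (s≤s i<j) (s≤s j<l) =
      Grouped⇒Consecutive g i j l i<j j<l
    Grouped⇒Consecutive (inj₂ x∉ ∷ _) fzero (fsuc j) (fsuc l) _ _ xl =
      ⊥-elim (x∉ (lose (∈-lookup l) xl))
    Grouped⇒Consecutive (inj₁ x≈y ∷ _) fzero (fsuc fzero) (fsuc l) _ _ _ = sym x≈y
    Grouped⇒Consecutive (inj₁ x≈y ∷ g) fzero (fsuc (fsuc j)) (fsuc l) _ (s≤s j<l) xl =
      trans (Grouped⇒Consecutive g fzero (fsuc j) l (s≤s z≤n) j<l (trans (sym x≈y) xl)) (sym x≈y)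

    Consecutive⇒Grouped : ∀ L → Consecutive L → Grouped L
    Consecutive⇒Grouped []          _ = []
    Consecutive⇒Grouped (x ∷ [])    _ = [ x ]
    Consecutive⇒Grouped (x ∷ y ∷ L) c = head-block (key x ≟ key y) ∷ Consecutive⇒Grouped (y ∷ L) c′
      where
      c′ : Consecutive (y ∷ L)
      c′ i j l i<j j<l = c (fsuc i) (fsuc j) (fsuc l) (s≤s i<j) (s≤s j<l)

      head-block : Dec (key x ≡ key y) → key x ≡ key y ⊎ ¬ KeyOccurs x (y ∷ L)
      head-block (yes x≈y) = inj₁ x≈y
      head-block (no x≉y)  = inj₂ λ
        { (here x≈y) → x≉y x≈y
        ; (there p)  → x≉y (sym (c fzero (fsuc fzero) (fsuc (fsuc (Any.index p)))
                                   (s≤s z≤n) (s≤s (s≤s z≤n)) (lookup-index p)))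
        }

    fresh≤differ : ∀ x y L → fresh x (y ∷ L) ≤ differ (key x) (key y)
    fresh≤differ x y L = by-cases (key x ≟ key y)
      where
      by-cases : Dec (key x ≡ key y) → fresh x (y ∷ L) ≤ differ (key x) (key y)
      by-cases (yes x≈y) = ≤-trans (≤-reflexive (fresh-occurs (here x≈y))) z≤n
      by-cases (no x≉y)  = subst (fresh x (y ∷ L) ≤_) (sym (differ-≢ x≉y)) (fresh≤1 x (y ∷ L))

    distinctKeys≤1+breaks : ∀ x L → distinctKeys (x ∷ L) ≤ suc (breaks (x ∷ L))
    distinctKeys≤1+breaks x []      = +-monoˡ-≤ 0 (fresh≤1 x [])
    distinctKeys≤1+breaks x (y ∷ L) = subst (distinctKeys (x ∷ y ∷ L) ≤_) (+-suc _ _)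
      (+-mono-≤ (fresh≤differ x y L) (distinctKeys≤1+breaks y L))

    Grouped⇒distinctKeys≡1+breaks : ∀ {x L} → Grouped (x ∷ L) → distinctKeys (x ∷ L) ≡ suc (breaks (x ∷ L))
    Grouped⇒distinctKeys≡1+breaks [ x ]     = refl
    Grouped⇒distinctKeys≡1+breaks (block ∷ g) =
      trans (cong₂ _+_ (fresh≡differ block) (Grouped⇒distinctKeys≡1+breaks g)) (+-suc _ _)
      where
      fresh≡differ : ∀ {x y L} → key x ≡ key y ⊎ ¬ KeyOccurs x (y ∷ L) → fresh x (y ∷ L) ≡ differ (key x) (key y)
      fresh≡differ (inj₁ x≈y) = trans (fresh-occurs (here x≈y)) (sym (differ-≡ x≈y))
      fresh≡differ (inj₂ x∉) = trans (fresh-¬occurs x∉) (sym (differ-≢ (x∉ ∘ here)))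

    1+breaks≤distinctKeys⇒Grouped : ∀ x L → suc (breaks (x ∷ L)) ≤ distinctKeys (x ∷ L) → Grouped (x ∷ L)
    1+breaks≤distinctKeys⇒Grouped x []      _ = [ x ]
    1+breaks≤distinctKeys⇒Grouped x (y ∷ L) h =
      head-block (key x ≟ key y) ∷ 1+breaks≤distinctKeys⇒Grouped y L tail-tight
      where
      summands : differ (key x) (key y) ≤ fresh x (y ∷ L) × suc (breaks (y ∷ L)) ≤ distinctKeys (y ∷ L)
      summands = ≤-summands (fresh≤differ x y L) (distinctKeys≤1+breaks y L)
        (subst (_≤ distinctKeys (x ∷ y ∷ L)) (sym (+-suc (differ (key x) (key y)) (breaks (y ∷ L)))) h)

      differ≤fresh : differ (key x) (key y) ≤ fresh x (y ∷ L)
      differ≤fresh = proj₁ summands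

      tail-tight : suc (breaks (y ∷ L)) ≤ distinctKeys (y ∷ L)
      tail-tight = proj₂ summands

      head-block : Dec (key x ≡ key y) → key x ≡ key y ⊎ ¬ KeyOccurs x (y ∷ L)
      head-block (yes x≈y) = inj₁ x≈y
      head-block (no x≉y)  = inj₂ λ occ →
        1+n≰n (subst₂ _≤_ (differ-≢ x≉y) (fresh-occurs occ) differ≤fresh)

    breaks-↭-minimal : ∀ {L L′} → L ↭ L′ → Consecutive L → breaks L ≤ breaks L′
    breaks-↭-minimal {[]}              _ _ = z≤n
    breaks-↭-minimal {x ∷ L} {[]}      σ _ = ⊥-elim (¬x∷xs↭[] σ)
    breaks-↭-minimal {x ∷ L} {y ∷ L′} σ c = s≤s⁻¹ (begin
      suc (breaks (x ∷ L))   ≡⟨ Grouped⇒distinctKeys≡1+breaks (Consecutive⇒Grouped (x ∷ L) c) ⟨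
      distinctKeys (x ∷ L)   ≡⟨ distinctKeys-↭ σ ⟩
      distinctKeys (y ∷ L′)  ≤⟨ distinctKeys≤1+breaks y L′ ⟩
      suc (breaks (y ∷ L′))  ∎)
      where open ≤-Reasoning

    breaks-↭-tight⇒Consecutive : ∀ {L L′} → L ↭ L′ → Consecutive L → breaks L′ ≤ breaks L → Consecutive L′
    breaks-↭-tight⇒Consecutive {L′ = []}       _ _ _ = Grouped⇒Consecutive []
    breaks-↭-tight⇒Consecutive {[]} {y ∷ L′}   σ _ _ = ⊥-elim (¬x∷xs↭[] (↭-sym σ))
    breaks-↭-tight⇒Consecutive {x ∷ L} {y ∷ L′} σ c tight =
      Grouped⇒Consecutive (1+breaks≤distinctKeys⇒Grouped y L′ (begin
        suc (breaks (y ∷ L′))  ≤⟨ s≤s tight ⟩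
        suc (breaks (x ∷ L))   ≡⟨ Grouped⇒distinctKeys≡1+breaks (Consecutive⇒Grouped (x ∷ L) c) ⟨
        distinctKeys (x ∷ L)   ≡⟨ distinctKeys-↭ σ ⟩
        distinctKeys (y ∷ L′)  ∎))
      where open ≤-Reasoning

  Consecutive-cong : ∀ {A : Set} {f g : A → K} {L} → (∀ x → f x ≡ g x) → Consecutive f L → Consecutive g L
  Consecutive-cong f≡g c i j l i<j j<l gi≡gl =
    trans (sym (f≡g _)) (trans (c i j l i<j j<l (trans (f≡g _) (trans gi≡gl (sym (f≡g _))))) (f≡g _))

_≟ˢ_ : DecidableEquality (List Bool)
_≟ˢ_ = ≡-dec _≟ᴮ_

open Keys _≟ˢ_

lam-self : ∀ {n} (x : Bits n) → lam x x ≡ 0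
lam-self []ᵛ = refl
lam-self (a ∷ᵛ x) rewrite lam-self x with a ≟ᴮ a
... | yes _   = refl
... | no a≢a = ⊥-elim (a≢a refl)

lam≡0⇒≡ : ∀ {n} (x y : Bits n) → lam x y ≡ 0 → x ≡ y
lam≡0⇒≡ []ᵛ []ᵛ _ = refl
lam≡0⇒≡ (a ∷ᵛ x) (b ∷ᵛ y) lam≡0 with lam x y in tail≡0
... | zero with a ≟ᴮ b
...   | yes refl = cong (a ∷ᵛ_) (lam≡0⇒≡ x y tail≡0)
lam≡0⇒≡ (a ∷ᵛ x) (b ∷ᵛ y) () | zero | no _
lam≡0⇒≡ (a ∷ᵛ x) (b ∷ᵛ y) () | suc _

lam-∷ : ∀ {n} a b (x y : Bits n) → lam (a ∷ᵛ x) (b ∷ᵛ y) ≡ lam x y + differ (a ∷ toList x) (b ∷ toList y)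
lam-∷ a b x y with lam x y in lam≡
... | zero  = head-decides (lam≡0⇒≡ x y lam≡) (a ≟ᴮ b)
  where
  head-decides : x ≡ y → (d : Dec (a ≡ b)) → (if does d then 0 else 1) ≡ differ (a ∷ toList x) (b ∷ toList y)
  head-decides refl (yes refl) = sym (differ-≡ refl)
  head-decides refl (no a≢b)   = sym (differ-≢ (a≢b ∘ ∷-injectiveˡ))
... | suc m = sym (trans (cong (suc m +_) (differ-≢ tails-differ)) (+-comm (suc m) 1))
  where
  tails-differ : ¬ a ∷ toList x ≡ b ∷ toList y
  tails-differ eq with trans (sym (cast-is-id refl x)) (toList-injective refl x y (∷-injectiveʳ eq))
  ... | refl = 0≢1+n (trans (sym (lam-self x)) lam≡)

suffix-∷ : ∀ {m} k a (x : Bits m) → k ≤ m → suffix k (a ∷ᵛ x) ≡ suffix k x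
suffix-∷ k a x k≤m rewrite +-∸-assoc 1 k≤m = refl

suffix-self : ∀ {n} (x : Bits n) → suffix n x ≡ toList x
suffix-self {n} x rewrite n∸n≡0 n = refl

suffix-0 : ∀ {n} (x : Bits n) → suffix 0 x ≡ []
suffix-0 x = drop-all _ (toList x) (≤-reflexive (length-toList x))

suffix-≥ : ∀ {n} k (x : Bits n) → n ≤ k → suffix k x ≡ suffix n x
suffix-≥ {n} k x n≤k rewrite m≤n⇒m∸n≡0 n≤k | n∸n≡0 n = refl

lam-as-sum : ∀ {n} (x y : Bits n) → lam x y ≡ sumBelow n (λ k → differ (suffix (suc k) x) (suffix (suc k) y))
lam-as-sum []ᵛ []ᵛ = refl
lam-as-sum {suc m} (a ∷ᵛ x) (b ∷ᵛ y) = begin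
  lam (a ∷ᵛ x) (b ∷ᵛ y)
    ≡⟨ lam-∷ a b x y ⟩
  lam x y + differ (a ∷ toList x) (b ∷ toList y)
    ≡⟨ cong (_+ differ (a ∷ toList x) (b ∷ toList y)) (lam-as-sum x y) ⟩
  sumBelow m (λ k → differ (suffix (suc k) x) (suffix (suc k) y)) + differ (a ∷ toList x) (b ∷ toList y)
    ≡⟨ cong₂ _+_ (sumBelow-cong m λ k k<m → sym (cong₂ differ (suffix-∷ (suc k) a x k<m) (suffix-∷ (suc k) b y k<m)))
                 (sym (cong₂ differ (suffix-self (a ∷ᵛ x)) (suffix-self (b ∷ᵛ y)))) ⟩
  sumBelow (suc m) (λ k → differ (suffix (suc k) (a ∷ᵛ x)) (suffix (suc k) (b ∷ᵛ y)))  ∎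
  where open ≡-Reasoning

cost-as-sum : ∀ {n} (L : List (Bits n)) → cost L ≡ sumBelow n (λ k → breaks (suffix (suc k)) L)
cost-as-sum {n} []          = sym (sumBelow-0 n)
cost-as-sum {n} (x ∷ [])    = sym (sumBelow-0 n)
cost-as-sum {n} (x ∷ y ∷ L) =
  trans (cong₂ _+_ (lam-as-sum x y) (cost-as-sum (y ∷ L)))
        (sym (sumBelow-+ n (λ k → differ (suffix (suc k) x) (suffix (suc k) y)) (λ k → breaks (suffix (suc k)) (y ∷ L))))

Consecutive-suffixes⇒Genlex : ∀ {n} (L : List (Bits n)) → (∀ k → k < n → Consecutive (suffix (suc k)) L) → Genlex L
Consecutive-suffixes⇒Genlex {n} L consecutive k = by-cases (k ≤? n)
  where
  bounded : ∀ j → j ≤ n → Consecutive (suffix j) L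
  bounded zero    _   i j _ _ _ _ = trans (suffix-0 (lookup L j)) (sym (suffix-0 (lookup L i)))
  bounded (suc j) j<n = consecutive j j<n

  by-cases : Dec (k ≤ n) → Consecutive (suffix k) L
  by-cases (yes k≤n) = bounded k k≤n
  by-cases (no k≰n)  = Consecutive-cong {L = L} (λ x → sym (suffix-≥ k x (≰⇒≥ k≰n))) (bounded n ≤-refl)

lemma2 : (n : ℕ) (X L L′ : List (Bits n)) → Unique X →
    IsOrdering X L → IsOrdering X L′ → Genlex L →
    (cost L ≤ cost L′) × (¬ Genlex L′ → cost L < cost L′)
lemma2 n X L L′ _ L↭X L′↭X genlex = cost-≤ , cost-<
  where
  L↭L′ : L ↭ L′
  L↭L′ = ↭-trans L↭X (↭-sym L′↭X)

  breaks≤ : ∀ k → k < n → breaks (suffix (suc k)) L ≤ breaks (suffix (suc k)) L′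
  breaks≤ k _ = breaks-↭-minimal (suffix (suc k)) L↭L′ (genlex (suc k))

  cost-≤ : cost L ≤ cost L′
  cost-≤ = subst₂ _≤_ (sym (cost-as-sum L)) (sym (cost-as-sum L′)) (sumBelow-mono n breaks≤)

  cost-< : ¬ Genlex L′ → cost L < cost L′
  cost-< ¬genlex′ with cost L <? cost L′
  ... | yes cost< = cost<
  ... | no cost≮ = ⊥-elim (¬genlex′ (Consecutive-suffixes⇒Genlex L′ λ k k<n →
    breaks-↭-tight⇒Consecutive (suffix (suc k)) L↭L′ (genlex (suc k))
      (sumBelow-tight n breaks≤ (subst₂ _≤_ (cost-as-sum L′) (cost-as-sum L) (≮⇒≥ cost≮)) k k<n)))
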